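{- Let $\lambda\in\mathbb{C}$ with $\lambda\neq 1$, let $r,k\in\mathbb{Z}$ and $n\in\mathbb{Z}_{\geq 0}$. Then \[ \sum_{m=0}^{n}\binom{n+1}{m}(-1)^{n-m}T_{m}^{(r,k)}(\lambda)=\sum_{l=0}^{n} \sum_{m=0}^{l}(-1)^{l-m}\binom{l}{m}\binom{n+1}{l+1}B_{m}^{(k-1)} H_{n-l}^{(r)}(\lambda). \]
   Context: For $k\in\mathbb{Z}$, $Li_k(x)=\sum_{n\ge1}x^n/n^k$. For $r,k\in\mathbb{Z}$ the polynomials $T_n^{(r,k)}(x|\lambda)$ are defined by $\left(\frac{1-\lambda}{e^t-\lambda}\right)^r\frac{Li_{k}(1-e^{ -t})}{1-e^{ -t}}e^{xt}=\sum_{n\ge0}T_n^{(r,k)}(x|\lambda)\frac{t^n}{n!}$ (as formal power series in $t$), and $T_n^{(r,k)}(\lambda)=T_n^{(r,k)}(0|\lambda)$. The Frobenius-Euler numbers of order $r$ are defined by $\left(\frac{1-\lambda}{e^t-\lambda}\right)^{r}=\sum_{n\ge0}H_n^{(r)}(\lambda)\frac{t^n}{n!}$. The poly-Bernoulli numbers $B_m^{(k)}$ are defined by $\frac{Li_k(1-e^{ -t})}{1-e^{ -t}}=\sum_{m\ge0}B_m^{(k)}\frac{t^m}{m!}$. -}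

module Defs where

open import Level using (Level)
open import Data.Nat as ℕ using (ℕ; zero; suc; _∸_)
open import Data.Nat.Combinatorics using (_C_)
open import Data.Integer using (ℤ; +_; -[1+_])
open import Algebra.Bundles using (CommutativeRing)

-- All objects live over a commutative ring R in which every positive integer
-- is invertible (a commutative Q-algebra, e.g. the complex numbers).
-- `inv n` is the chosen inverse of n+1 (the hypothesis of the theorem states
-- that it really is an inverse).
module Series {c ℓ : Level} (R : CommutativeRing c ℓ) (inv : ℕ → CommutativeRing.Carrier R) where
  open CommutativeRing R hiding (zero)

  ι : ℕ → Carrier
  ι zero    = 0#
  ι (suc n) = 1# + ι n

  infixr 8 _^'_
  _^'_ : Carrier → ℕ → Carrier
  x ^' zero  = 1#
  x ^' suc n = x * (x ^' n)

  sumTo : ℕ → (ℕ → Carrier) → Carrier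
  sumTo zero    f = f zero
  sumTo (suc n) f = sumTo n f + f (suc n)

  invFact : ℕ → Carrier
  invFact zero    = 1#
  invFact (suc n) = inv n * invFact n

  PS : Set c
  PS = ℕ → Carrier

  oneS : PS
  oneS zero    = 1#
  oneS (suc n) = 0#

  scaleS : Carrier → PS → PS
  scaleS a f n = a * f n

  _⊛_ : PS → PS → PS
  (f ⊛ g) n = sumTo n (λ i → f i * g (n ∸ i))

  powS : PS → ℕ → PS
  powS f zero    = oneS
  powS f (suc n) = f ⊛ powS f n

  -- composition  Σ_j a_j y^j  for a series y with zero constant term
  -- (only the terms j ≤ n contribute to the coefficient of t^n)
  composeS : PS → PS → PS
  composeS a y n = sumTo n (λ j → a j * powS y j n)

  expS : Carrier → PS
  expS x n = (x ^' n) * invFact n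

  expm1 : PS
  expm1 zero    = 0#
  expm1 (suc n) = invFact (suc n)

  oneMinusExpNeg : PS
  oneMinusExpNeg zero    = 0#
  oneMinusExpNeg (suc n) = - (((- 1#) ^' suc n) * invFact (suc n))

  -- Li_k(x)/x = Σ_{j≥0} x^j/(j+1)^k  as a series in x
  liOverX : ℤ → PS
  liOverX (+ k)      j = inv j ^' k
  liOverX (-[1+ k ]) j = ι (suc j) ^' suc k

  polyBGen : ℤ → PS
  polyBGen k = composeS (liOverX k) oneMinusExpNeg

  -- (1-λ)/(e^t-λ) = 1/(1 + μ (e^t-1)) where μ = 1/(1-λ)
  -- = Σ_j (-1)^j (μ (e^t - 1))^j
  FE1 : Carrier → PS
  FE1 μ = composeS (λ j → (- 1#) ^' j) (scaleS μ expm1)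

  -- (e^t-λ)/(1-λ) = 1 + μ (e^t-1)
  FE1inv : Carrier → PS
  FE1inv μ zero    = 1#
  FE1inv μ (suc n) = μ * expm1 (suc n)

  FEpow : Carrier → ℤ → PS
  FEpow μ (+ r)      = powS (FE1 μ) r
  FEpow μ (-[1+ r ]) = powS (FE1inv μ) (suc r)

  -- Frobenius-Euler numbers of order r: H_n^{(r)}(λ), with μ = 1/(1-λ)
  H : ℤ → Carrier → ℕ → Carrier
  H r μ n = ι (n ℕ.!) * FEpow μ r n

  B : ℤ → ℕ → Carrier
  B k m = ι (m ℕ.!) * polyBGen k m

  Tx : ℤ → ℤ → Carrier → Carrier → ℕ → Carrier
  Tx r k x μ n = ι (n ℕ.!) * ((FEpow μ r ⊛ polyBGen k) ⊛ expS x) n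

  T : ℤ → ℤ → Carrier → ℕ → Carrier
  T r k μ n = Tx r k 0# μ n

  binom : ℕ → ℕ → Carrier
  binom n m = ι (n C m)

  sign : ℕ → Carrier
  sign m = (- 1#) ^' m

{-# OPTIONS --safe #-}
module Submission where

-- Put y = 1 - e^{-t}, P_k = Li_k(y)/y and G = ((1-λ)/(e^t-λ))^r. Both sides equal
-- (n+1)! [t^{n+1}] y G P_k. On the left this is the expansion y = Σ_{j≥1} (-1)^{j-1} t^j/j!.
-- On the right, differentiating Li_k(y) = y P_k gives e^{-t} P_{k-1}, so the inner sum
-- Σ_m (-1)^{l-m} C(l,m) B_m^{(k-1)} = l! [t^l] e^{-t} P_{k-1} equals (l+1)! [t^{l+1}] y P_k,
-- and the outer sum is (n+1)! times the coefficient of t^{n+1} in (y P_k) G.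

open import Defs
open import Level using (Level)
open import Data.Nat using (ℕ; suc; _∸_)
open import Data.Integer using (ℤ; +_; -[1+_]) renaming (_-_ to _-ℤ_)
open import Algebra.Bundles using (CommutativeRing)

open import Data.Nat as ℕ using (zero; _≤_; _<_; z≤n; s≤s; _!)
import Data.Nat.Properties as ℕₚ
open import Data.Nat.Properties using (_!*_!≢0)
open import Data.Nat.Combinatorics using (_C_; nCk≡n!/k![n-k]!; k![n∸k]!∣n!)
open import Data.Nat.DivMod using (m/n*n≡m)
open import Data.Sum using (inj₁; inj₂)
import Relation.Binary.PropositionalEquality as P
open P using (_≡_)
import Algebra.Solver.CommutativeMonoid as CommutativeMonoidSolver

nCk*k![n∸k]!≡n! : ∀ {n k} → k ≤ n → (n C k) ℕ.* (k ! ℕ.* (n ∸ k) !) ≡ n !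
nCk*k![n∸k]!≡n! {n} {k} k≤n = P.trans
  (P.cong (ℕ._* (k ! ℕ.* (n ∸ k) !)) (nCk≡n!/k![n-k]! k≤n))
  (m/n*n≡m (k![n∸k]!∣n! k≤n))
  where instance _ = k !* (n ∸ k) !≢0

module SeriesAlgebra {c ℓ : Level} (R : CommutativeRing c ℓ)
                     (inv : ℕ → CommutativeRing.Carrier R) where

  open CommutativeRing R hiding (zero)
  open Series R inv
  open import Relation.Binary.Reasoning.Setoid setoid
  open import Algebra.Properties.CommutativeSemigroup +-commutativeSemigroup
    using () renaming (interchange to +-interchange)
  open import Algebra.Properties.CommutativeSemigroup *-commutativeSemigroup
    using (x∙yz≈y∙xz)
  open import Algebra.Properties.Semiring.Mult semiring using (_×_; ×-homo-+; ×1-homo-*)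

  InverseOfSuc : Set ℓ
  InverseOfSuc = ∀ n → ι (suc n) * inv n ≈ 1#

  sumTo-cong-≤ : ∀ n {f g : ℕ → Carrier} → (∀ i → i ≤ n → f i ≈ g i) → sumTo n f ≈ sumTo n g
  sumTo-cong-≤ zero    f≈g = f≈g 0 z≤n
  sumTo-cong-≤ (suc n) f≈g =
    +-cong (sumTo-cong-≤ n (λ i i≤n → f≈g i (ℕₚ.m≤n⇒m≤1+n i≤n))) (f≈g (suc n) ℕₚ.≤-refl)

  sumTo-cong : ∀ n {f g : ℕ → Carrier} → (∀ i → f i ≈ g i) → sumTo n f ≈ sumTo n g
  sumTo-cong n f≈g = sumTo-cong-≤ n (λ i _ → f≈g i)

  sumTo-zero : ∀ n {f : ℕ → Carrier} → (∀ i → i ≤ n → f i ≈ 0#) → sumTo n f ≈ 0#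
  sumTo-zero zero    f≈0 = f≈0 0 z≤n
  sumTo-zero (suc n) f≈0 = trans
    (+-cong (sumTo-zero n (λ i i≤n → f≈0 i (ℕₚ.m≤n⇒m≤1+n i≤n))) (f≈0 (suc n) ℕₚ.≤-refl))
    (+-identityˡ 0#)

  sumTo-+ : ∀ n (f g : ℕ → Carrier) → sumTo n (λ i → f i + g i) ≈ sumTo n f + sumTo n g
  sumTo-+ zero    f g = refl
  sumTo-+ (suc n) f g = trans (+-congʳ (sumTo-+ n f g)) (+-interchange _ _ _ _)

  *-distribˡ-sumTo : ∀ n a (f : ℕ → Carrier) → a * sumTo n f ≈ sumTo n (λ i → a * f i)
  *-distribˡ-sumTo zero    a f = refl
  *-distribˡ-sumTo (suc n) a f = trans (distribˡ a _ _) (+-congʳ (*-distribˡ-sumTo n a f))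

  *-distribʳ-sumTo : ∀ n a (f : ℕ → Carrier) → sumTo n f * a ≈ sumTo n (λ i → f i * a)
  *-distribʳ-sumTo zero    a f = refl
  *-distribʳ-sumTo (suc n) a f = trans (distribʳ a _ _) (+-congʳ (*-distribʳ-sumTo n a f))

  sumTo-comm : ∀ n m (F : ℕ → ℕ → Carrier) →
               sumTo n (λ i → sumTo m (F i)) ≈ sumTo m (λ j → sumTo n (λ i → F i j))
  sumTo-comm zero    m F = refl
  sumTo-comm (suc n) m F = trans (+-congʳ (sumTo-comm n m F)) (sym (sumTo-+ m _ _))

  sumTo-suc : ∀ n (f : ℕ → Carrier) → sumTo (suc n) f ≈ f 0 + sumTo n (λ i → f (suc i))
  sumTo-suc zero    f = refl
  sumTo-suc (suc n) f = trans (+-congʳ (sumTo-suc n f)) (+-assoc _ _ _)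

  sumTo-reverse : ∀ n (f : ℕ → Carrier) → sumTo n f ≈ sumTo n (λ i → f (n ∸ i))
  sumTo-reverse zero    f = refl
  sumTo-reverse (suc n) f = begin
    sumTo n f + f (suc n)                  ≈⟨ +-comm _ _ ⟩
    f (suc n) + sumTo n f                  ≈⟨ +-congˡ (sumTo-reverse n f) ⟩
    f (suc n) + sumTo n (λ i → f (n ∸ i))  ≈⟨ sumTo-suc n (λ i → f (suc n ∸ i)) ⟨
    sumTo (suc n) (λ i → f (suc n ∸ i))    ∎

  sumTo-extend : ∀ {n} N (f : ℕ → Carrier) → n ≤ N →
                 (∀ i → n < i → i ≤ N → f i ≈ 0#) → sumTo N f ≈ sumTo n f
  sumTo-extend zero    f z≤n  _   = refl
  sumTo-extend (suc N) f n≤1+N f≈0 with ℕₚ.m≤n⇒m<n∨m≡n n≤1+N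
  ... | inj₂ P.refl      = refl
  ... | inj₁ (s≤s n≤N) = trans
    (+-cong (sumTo-extend N f n≤N (λ i n<i i≤N → f≈0 i n<i (ℕₚ.m≤n⇒m≤1+n i≤N)))
            (f≈0 (suc N) (s≤s n≤N) ℕₚ.≤-refl))
    (+-identityʳ _)

  sumTo-last : ∀ n (f : ℕ → Carrier) → (∀ i → i < n → f i ≈ 0#) → sumTo n f ≈ f n
  sumTo-last zero    f f≈0 = refl
  sumTo-last (suc n) f f≈0 = trans (+-congʳ (sumTo-zero n (λ i i≤n → f≈0 i (s≤s i≤n))))
                                   (+-identityˡ _)

  sumTo-triangle : ∀ n (F : ℕ → ℕ → Carrier) →
    sumTo n (λ i → sumTo i (λ j → F j i)) ≈ sumTo n (λ j → sumTo (n ∸ j) (λ k → F j (j ℕ.+ k)))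
  sumTo-triangle zero    F = refl
  sumTo-triangle (suc n) F = begin
    sumTo n (λ i → sumTo i (λ j → F j i)) + sumTo (suc n) (λ j → F j (suc n))
      ≈⟨ +-congʳ (sumTo-triangle n F) ⟩
    sumTo n row + (sumTo n (λ j → F j (suc n)) + F (suc n) (suc n))
      ≈⟨ +-assoc _ _ _ ⟨
    (sumTo n row + sumTo n (λ j → F j (suc n))) + F (suc n) (suc n)
      ≈⟨ +-congʳ (sumTo-+ n _ _) ⟨
    sumTo n (λ j → row j + F j (suc n)) + F (suc n) (suc n)
      ≈⟨ +-cong (sumTo-cong-≤ n extend-row) (reflexive last-row) ⟩
    sumTo n (λ j → sumTo (suc n ∸ j) (λ k → F j (j ℕ.+ k)))
      + sumTo (suc n ∸ suc n) (λ k → F (suc n) (suc n ℕ.+ k)) ∎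
    where
    row : ℕ → Carrier
    row j = sumTo (n ∸ j) (λ k → F j (j ℕ.+ k))
    extend-row : ∀ j → j ≤ n → row j + F j (suc n) ≈ sumTo (suc n ∸ j) (λ k → F j (j ℕ.+ k))
    extend-row j j≤n = reflexive (P.trans
      (P.cong (λ m → row j + F j m) (P.sym j+[1+n∸j]≡1+n))
      (P.cong (λ N → sumTo N (λ k → F j (j ℕ.+ k))) (P.sym (ℕₚ.+-∸-assoc 1 j≤n))))
      where
      j+[1+n∸j]≡1+n : j ℕ.+ suc (n ∸ j) ≡ suc n
      j+[1+n∸j]≡1+n = P.trans (ℕₚ.+-suc j (n ∸ j)) (P.cong suc (ℕₚ.m+[n∸m]≡n j≤n))
    last-row : F (suc n) (suc n) ≡ sumTo (suc n ∸ suc n) (λ k → F (suc n) (suc n ℕ.+ k))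
    last-row = P.sym (P.trans (P.cong (λ N → sumTo N (λ k → F (suc n) (suc n ℕ.+ k))) (ℕₚ.n∸n≡0 n))
                              (P.cong (F (suc n)) (ℕₚ.+-identityʳ (suc n))))

  infix 4 _≋_
  _≋_ : PS → PS → Set ℓ
  f ≋ g = ∀ n → f n ≈ g n

  ⊛-congˡ : ∀ {f f′} g → f ≋ f′ → (f ⊛ g) ≋ (f′ ⊛ g)
  ⊛-congˡ g f≋f′ n = sumTo-cong n (λ i → *-congʳ (f≋f′ i))

  ⊛-congʳ : ∀ f {g g′} → g ≋ g′ → (f ⊛ g) ≋ (f ⊛ g′)
  ⊛-congʳ f g≋g′ n = sumTo-cong n (λ i → *-congˡ (g≋g′ (n ∸ i)))

  ⊛-comm : ∀ f g → (f ⊛ g) ≋ (g ⊛ f)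
  ⊛-comm f g n = trans (sumTo-reverse n _) (sumTo-cong-≤ n (λ i i≤n →
    trans (*-comm _ _) (*-congʳ (reflexive (P.cong g (ℕₚ.m∸[m∸n]≡n i≤n))))))

  ⊛-assoc : ∀ f g h → ((f ⊛ g) ⊛ h) ≋ (f ⊛ (g ⊛ h))
  ⊛-assoc f g h n = begin
    sumTo n (λ i → sumTo i (λ j → f j * g (i ∸ j)) * h (n ∸ i))
      ≈⟨ sumTo-cong n (λ i → *-distribʳ-sumTo i _ _) ⟩
    sumTo n (λ i → sumTo i (λ j → f j * g (i ∸ j) * h (n ∸ i)))
      ≈⟨ sumTo-triangle n (λ j i → f j * g (i ∸ j) * h (n ∸ i)) ⟩
    sumTo n (λ j → sumTo (n ∸ j) (λ k → f j * g ((j ℕ.+ k) ∸ j) * h (n ∸ (j ℕ.+ k))))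
      ≈⟨ sumTo-cong n (λ j → trans (sumTo-cong (n ∸ j) (reindex j))
                                   (sym (*-distribˡ-sumTo (n ∸ j) _ _))) ⟩
    sumTo n (λ j → f j * sumTo (n ∸ j) (λ k → g k * h ((n ∸ j) ∸ k))) ∎
    where
    reindex : ∀ j k → f j * g ((j ℕ.+ k) ∸ j) * h (n ∸ (j ℕ.+ k)) ≈ f j * (g k * h ((n ∸ j) ∸ k))
    reindex j k = trans (*-assoc _ _ _) (*-congˡ (*-cong
      (reflexive (P.cong g (ℕₚ.m+n∸m≡n j k)))
      (reflexive (P.cong h (P.sym (ℕₚ.∸-+-assoc n j k))))))

  ⊛-leftComm : ∀ f g h → (f ⊛ (g ⊛ h)) ≋ (g ⊛ (f ⊛ h))
  ⊛-leftComm f g h n = begin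
    (f ⊛ (g ⊛ h)) n ≈⟨ ⊛-assoc f g h n ⟨
    ((f ⊛ g) ⊛ h) n ≈⟨ ⊛-congˡ h (⊛-comm f g) n ⟩
    ((g ⊛ f) ⊛ h) n ≈⟨ ⊛-assoc g f h n ⟩
    (g ⊛ (f ⊛ h)) n ∎

  ⊛-scaleʳ : ∀ f a g → (f ⊛ scaleS a g) ≋ scaleS a (f ⊛ g)
  ⊛-scaleʳ f a g n = trans (sumTo-cong n (λ i → x∙yz≈y∙xz _ _ _)) (sym (*-distribˡ-sumTo n a _))

  ⊛-zeroʳ : ∀ f g → g ≋ (λ _ → 0#) → (f ⊛ g) ≋ (λ _ → 0#)
  ⊛-zeroʳ f g g≋0 n = sumTo-zero n (λ i _ → trans (*-congˡ (g≋0 _)) (zeroʳ _))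

  ⊛-unitʳ : ∀ f g → g 0 ≈ 1# → (∀ m → g (suc m) ≈ 0#) → (f ⊛ g) ≋ f
  ⊛-unitʳ f g g₀≈1 g₊≈0 n = begin
    (f ⊛ g) n        ≈⟨ sumTo-last n _ (λ i i<n → trans (*-congˡ (g-pos (ℕₚ.m<n⇒0<n∸m i<n))) (zeroʳ _)) ⟩
    f n * g (n ∸ n)  ≡⟨ P.cong (λ m → f n * g m) (ℕₚ.n∸n≡0 n) ⟩
    f n * g 0        ≈⟨ *-congˡ g₀≈1 ⟩
    f n * 1#         ≈⟨ *-identityʳ _ ⟩
    f n              ∎
    where
    g-pos : ∀ {m} → 0 < m → g m ≈ 0#
    g-pos {suc m} _ = g₊≈0 m

  ⊛-sucˡ : ∀ f g n → f 0 ≈ 0# → (f ⊛ g) (suc n) ≈ sumTo n (λ i → f (suc i) * g (n ∸ i))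
  ⊛-sucˡ f g n f₀≈0 = begin
    (f ⊛ g) (suc n)                                 ≈⟨ sumTo-suc n _ ⟩
    f 0 * g (suc n) + sumTo n (λ i → f (suc i) * g (n ∸ i))
      ≈⟨ +-congʳ (trans (*-congʳ f₀≈0) (zeroˡ _)) ⟩
    0# + sumTo n (λ i → f (suc i) * g (n ∸ i))      ≈⟨ +-identityˡ _ ⟩
    sumTo n (λ i → f (suc i) * g (n ∸ i))           ∎

  ⊛-sucʳ : ∀ f g n → g 0 ≈ 0# → (f ⊛ g) (suc n) ≈ sumTo n (λ i → f i * g (suc n ∸ i))
  ⊛-sucʳ f g n g₀≈0 = trans (+-congˡ g-last≈0) (+-identityʳ _)
    where
    g-last≈0 : f (suc n) * g (suc n ∸ suc n) ≈ 0#
    g-last≈0 = trans (*-congˡ (trans (reflexive (P.cong g (ℕₚ.n∸n≡0 n))) g₀≈0)) (zeroʳ _)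

  ι≡×1 : ∀ n → ι n ≡ n × 1#
  ι≡×1 zero    = P.refl
  ι≡×1 (suc n) = P.cong (_+_ 1#) (ι≡×1 n)

  ι-+ : ∀ m n → ι (m ℕ.+ n) ≈ ι m + ι n
  ι-+ m n = begin
    ι (m ℕ.+ n)      ≡⟨ ι≡×1 (m ℕ.+ n) ⟩
    (m ℕ.+ n) × 1#   ≈⟨ ×-homo-+ 1# m n ⟩
    m × 1# + n × 1#  ≡⟨ P.cong₂ _+_ (ι≡×1 m) (ι≡×1 n) ⟨
    ι m + ι n        ∎

  ι-* : ∀ m n → ι (m ℕ.* n) ≈ ι m * ι n
  ι-* m n = begin
    ι (m ℕ.* n)        ≡⟨ ι≡×1 (m ℕ.* n) ⟩
    (m ℕ.* n) × 1#     ≈⟨ ×1-homo-* m n ⟩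
    (m × 1#) * (n × 1#) ≡⟨ P.cong₂ _*_ (ι≡×1 m) (ι≡×1 n) ⟨
    ι m * ι n          ∎

  deriv : PS → PS
  deriv f n = ι (suc n) * f (suc n)

  deriv-⊛ : ∀ f g → deriv (f ⊛ g) ≋ (λ n → (deriv f ⊛ g) n + (f ⊛ deriv g) n)
  deriv-⊛ f g n = begin
    ι (suc n) * sumTo (suc n) term                   ≈⟨ *-distribˡ-sumTo (suc n) _ _ ⟩
    sumTo (suc n) (λ i → ι (suc n) * term i)         ≈⟨ sumTo-cong-≤ (suc n) split ⟩
    sumTo (suc n) (λ i → ι i * term i + ι (suc n ∸ i) * term i)
      ≈⟨ sumTo-+ (suc n) _ _ ⟩
    sumTo (suc n) (λ i → ι i * term i) + sumTo (suc n) (λ i → ι (suc n ∸ i) * term i)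
      ≈⟨ +-cong deriv-left deriv-right ⟩
    (deriv f ⊛ g) n + (f ⊛ deriv g) n                ∎
    where
    term : ℕ → Carrier
    term i = f i * g (suc n ∸ i)
    split : ∀ i → i ≤ suc n → ι (suc n) * term i ≈ ι i * term i + ι (suc n ∸ i) * term i
    split i i≤1+n = trans (*-congʳ (trans (reflexive (P.cong ι (P.sym (ℕₚ.m+[n∸m]≡n i≤1+n))))
                                          (ι-+ i _)))
                          (distribʳ _ _ _)
    deriv-left : sumTo (suc n) (λ i → ι i * term i) ≈ (deriv f ⊛ g) n
    deriv-left = begin
      sumTo (suc n) (λ i → ι i * term i)                   ≈⟨ sumTo-suc n _ ⟩
      0# * term 0 + sumTo n (λ i → ι (suc i) * term (suc i)) ≈⟨ +-congʳ (zeroˡ _) ⟩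
      0# + sumTo n (λ i → ι (suc i) * term (suc i))        ≈⟨ +-identityˡ _ ⟩
      sumTo n (λ i → ι (suc i) * term (suc i))             ≈⟨ sumTo-cong n (λ i → sym (*-assoc _ _ _)) ⟩
      (deriv f ⊛ g) n                                      ∎
    deriv-right : sumTo (suc n) (λ i → ι (suc n ∸ i) * term i) ≈ (f ⊛ deriv g) n
    deriv-right = begin
      sumTo n (λ i → ι (suc n ∸ i) * term i) + ι (suc n ∸ suc n) * term (suc n)
        ≡⟨ P.cong (λ m → sumTo n (λ i → ι (suc n ∸ i) * term i) + ι m * term (suc n)) (ℕₚ.n∸n≡0 n) ⟩
      sumTo n (λ i → ι (suc n ∸ i) * term i) + 0# * term (suc n)
        ≈⟨ trans (+-congˡ (zeroˡ _)) (+-identityʳ _) ⟩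
      sumTo n (λ i → ι (suc n ∸ i) * term i)
        ≈⟨ sumTo-cong-≤ n (λ i i≤n → trans
             (reflexive (P.cong (λ m → ι m * (f i * g m)) (ℕₚ.+-∸-assoc 1 i≤n)))
             (x∙yz≈y∙xz _ _ _)) ⟩
      (f ⊛ deriv g) n                                      ∎

  deriv-powS : ∀ y j → deriv (powS y (suc j)) ≋ scaleS (ι (suc j)) (deriv y ⊛ powS y j)
  deriv-powS y zero l = begin
    deriv (y ⊛ oneS) l                          ≈⟨ deriv-⊛ y oneS l ⟩
    (deriv y ⊛ oneS) l + (y ⊛ deriv oneS) l     ≈⟨ +-congˡ (⊛-zeroʳ y (deriv oneS) (λ _ → zeroʳ _) l) ⟩
    (deriv y ⊛ oneS) l + 0#                     ≈⟨ +-identityʳ _ ⟩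
    (deriv y ⊛ oneS) l                          ≈⟨ *-identityˡ _ ⟨
    1# * (deriv y ⊛ oneS) l                     ≈⟨ *-congʳ (+-identityʳ 1#) ⟨
    ι 1 * (deriv y ⊛ oneS) l                    ∎
  deriv-powS y (suc j) l = begin
    deriv (y ⊛ yʲ⁺¹) l                                      ≈⟨ deriv-⊛ y yʲ⁺¹ l ⟩
    (deriv y ⊛ yʲ⁺¹) l + (y ⊛ deriv yʲ⁺¹) l                 ≈⟨ +-congˡ (⊛-congʳ y (deriv-powS y j) l) ⟩
    (deriv y ⊛ yʲ⁺¹) l + (y ⊛ scaleS (ι (suc j)) (deriv y ⊛ powS y j)) l
      ≈⟨ +-congˡ (⊛-scaleʳ y (ι (suc j)) (deriv y ⊛ powS y j) l) ⟩
    (deriv y ⊛ yʲ⁺¹) l + ι (suc j) * (y ⊛ (deriv y ⊛ powS y j)) l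
      ≈⟨ +-congˡ (*-congˡ (⊛-leftComm y (deriv y) (powS y j) l)) ⟩
    (deriv y ⊛ yʲ⁺¹) l + ι (suc j) * (deriv y ⊛ yʲ⁺¹) l     ≈⟨ +-congʳ (*-identityˡ _) ⟨
    1# * (deriv y ⊛ yʲ⁺¹) l + ι (suc j) * (deriv y ⊛ yʲ⁺¹) l ≈⟨ distribʳ _ _ _ ⟨
    ι (suc (suc j)) * (deriv y ⊛ yʲ⁺¹) l                    ∎
    where
    yʲ⁺¹ : PS
    yʲ⁺¹ = powS y (suc j)

  powS-vanish : ∀ {y} → y 0 ≈ 0# → ∀ j n → n < j → powS y j n ≈ 0#
  powS-vanish {y} y₀≈0 (suc j) n (s≤s n≤j) = sumTo-zero n term≈0
    where
    term≈0 : ∀ i → i ≤ n → y i * powS y j (n ∸ i) ≈ 0#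
    term≈0 zero    _   = trans (*-congʳ y₀≈0) (zeroˡ _)
    term≈0 (suc i) i<n = trans
      (*-congˡ (powS-vanish y₀≈0 j (n ∸ suc i)
        (ℕₚ.<-≤-trans (ℕₚ.∸-monoʳ-< (s≤s z≤n) i<n) n≤j)))
      (zeroʳ _)

  ⊛-composeS : ∀ {y} → y 0 ≈ 0# → ∀ (u a : PS) m M → m ≤ M →
               (u ⊛ composeS a y) m ≈ sumTo M (λ j → a j * (u ⊛ powS y j) m)
  ⊛-composeS {y} y₀≈0 u a m M m≤M = begin
    sumTo m (λ i → u i * composeS a y (m ∸ i))
      ≈⟨ sumTo-cong m (λ i → *-congˡ (sym (sumTo-extend M _ (ℕₚ.≤-trans (ℕₚ.m∸n≤m m i) m≤M)
            (λ j m∸i<j _ → trans (*-congˡ (powS-vanish y₀≈0 j (m ∸ i) m∸i<j)) (zeroʳ _))))) ⟩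
    sumTo m (λ i → u i * sumTo M (λ j → a j * powS y j (m ∸ i)))
      ≈⟨ sumTo-cong m (λ i → *-distribˡ-sumTo M _ _) ⟩
    sumTo m (λ i → sumTo M (λ j → u i * (a j * powS y j (m ∸ i))))
      ≈⟨ sumTo-comm m M _ ⟩
    sumTo M (λ j → sumTo m (λ i → u i * (a j * powS y j (m ∸ i))))
      ≈⟨ sumTo-cong M (λ j → trans (sumTo-cong m (λ i → x∙yz≈y∙xz _ _ _))
                                   (sym (*-distribˡ-sumTo m _ _))) ⟩
    sumTo M (λ j → a j * (u ⊛ powS y j) m) ∎

module ExponentialCoefficients {c ℓ : Level} (R : CommutativeRing c ℓ)
  (inv : ℕ → CommutativeRing.Carrier R) (ι[1+n]*inv[n]≈1 : SeriesAlgebra.InverseOfSuc R inv) where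

  open CommutativeRing R hiding (zero)
  open Series R inv
  open SeriesAlgebra R inv
  open import Relation.Binary.Reasoning.Setoid setoid
  open import Algebra.Properties.Ring ring using (-‿distribˡ-*; -‿involutive)
  open import Algebra.Properties.CommutativeSemigroup *-commutativeSemigroup
    using (interchange; x∙yz≈y∙xz; x∙yz≈yx∙z)
  open CommutativeMonoidSolver *-commutativeMonoid using (solve; _⊜_) renaming (_⊕_ to _·_)

  fact*invFact≈1 : ∀ n → ι (n !) * invFact n ≈ 1#
  fact*invFact≈1 zero    = trans (*-identityʳ _) (+-identityʳ _)
  fact*invFact≈1 (suc n) = begin
    ι (suc n ℕ.* n !) * (inv n * invFact n)      ≈⟨ *-congʳ (ι-* (suc n) (n !)) ⟩
    (ι (suc n) * ι (n !)) * (inv n * invFact n)  ≈⟨ interchange _ _ _ _ ⟩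
    (ι (suc n) * inv n) * (ι (n !) * invFact n)  ≈⟨ *-cong (ι[1+n]*inv[n]≈1 n) (fact*invFact≈1 n) ⟩
    1# * 1#                                      ≈⟨ *-identityʳ 1# ⟩
    1#                                           ∎

  fact≈binom*fact*fact : ∀ {n k} → k ≤ n → ι (n !) ≈ binom n k * (ι (k !) * ι ((n ∸ k) !))
  fact≈binom*fact*fact {n} {k} k≤n = begin
    ι (n !)                                        ≡⟨ P.cong ι (nCk*k![n∸k]!≡n! k≤n) ⟨
    ι ((n C k) ℕ.* (k ! ℕ.* (n ∸ k) !))            ≈⟨ ι-* (n C k) _ ⟩
    binom n k * ι (k ! ℕ.* (n ∸ k) !)              ≈⟨ *-congˡ (ι-* (k !) _) ⟩
    binom n k * (ι (k !) * ι ((n ∸ k) !))          ∎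

  fact*invFact≈binom*fact : ∀ {n k} → k ≤ n → ι (n !) * invFact (n ∸ k) ≈ binom n k * ι (k !)
  fact*invFact≈binom*fact {n} {k} k≤n = begin
    ι (n !) * invFact (n ∸ k)
      ≈⟨ *-congʳ (fact≈binom*fact*fact k≤n) ⟩
    binom n k * (ι (k !) * ι ((n ∸ k) !)) * invFact (n ∸ k)
      ≈⟨ solve 4 (λ b x y z → (b · (x · y)) · z ⊜ (b · x) · (y · z)) refl _ _ _ _ ⟩
    binom n k * ι (k !) * (ι ((n ∸ k) !) * invFact (n ∸ k))
      ≈⟨ *-congˡ (fact*invFact≈1 (n ∸ k)) ⟩
    binom n k * ι (k !) * 1#
      ≈⟨ *-identityʳ _ ⟩
    binom n k * ι (k !) ∎

  fact*[x*[s*invFact]] : ∀ {n k} → k ≤ n → ∀ s x →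
                         ι (n !) * (x * (s * invFact (n ∸ k))) ≈ binom n k * s * (ι (k !) * x)
  fact*[x*[s*invFact]] {n} {k} k≤n s x = begin
    ι (n !) * (x * (s * invFact (n ∸ k)))
      ≈⟨ solve 4 (λ a x s i → a · (x · (s · i)) ⊜ (a · i) · (s · x)) refl _ _ _ _ ⟩
    ι (n !) * invFact (n ∸ k) * (s * x)
      ≈⟨ *-congʳ (fact*invFact≈binom*fact k≤n) ⟩
    binom n k * ι (k !) * (s * x)
      ≈⟨ solve 4 (λ b f s x → (b · f) · (s · x) ⊜ (b · s) · (f · x)) refl _ _ _ _ ⟩
    binom n k * s * (ι (k !) * x) ∎

  expNeg : PS
  expNeg n = sign n * invFact n

  oneMinusExpNeg-suc : ∀ n → oneMinusExpNeg (suc n) ≈ sign n * invFact (suc n)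
  oneMinusExpNeg-suc n = begin
    - ((- 1# * sign n) * invFact (suc n))   ≈⟨ -‿cong (*-congʳ (-‿distribˡ-* 1# (sign n))) ⟨
    - (- (1# * sign n) * invFact (suc n))   ≈⟨ -‿cong (*-congʳ (-‿cong (*-identityˡ _))) ⟩
    - (- sign n * invFact (suc n))          ≈⟨ -‿cong (-‿distribˡ-* _ _) ⟨
    - - (sign n * invFact (suc n))          ≈⟨ -‿involutive _ ⟩
    sign n * invFact (suc n)                ∎

  deriv-oneMinusExpNeg : deriv oneMinusExpNeg ≋ expNeg
  deriv-oneMinusExpNeg n = begin
    ι (suc n) * oneMinusExpNeg (suc n)          ≈⟨ *-congˡ (oneMinusExpNeg-suc n) ⟩
    ι (suc n) * (sign n * (inv n * invFact n))
      ≈⟨ solve 4 (λ a s i f → a · (s · (i · f)) ⊜ (a · i) · (s · f)) refl _ _ _ _ ⟩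
    (ι (suc n) * inv n) * (sign n * invFact n)  ≈⟨ *-congʳ (ι[1+n]*inv[n]≈1 n) ⟩
    1# * expNeg n                               ≈⟨ *-identityˡ _ ⟩
    expNeg n                                    ∎

  liOverX-pred : ∀ k j → liOverX (k -ℤ + 1) j ≈ ι (suc j) * liOverX k j
  liOverX-pred (+ zero)  j = refl
  liOverX-pred (+ suc k) j = sym (begin
    ι (suc j) * (inv j * inv j ^' k)  ≈⟨ *-assoc _ _ _ ⟨
    (ι (suc j) * inv j) * inv j ^' k  ≈⟨ *-congʳ (ι[1+n]*inv[n]≈1 j) ⟩
    1# * inv j ^' k                   ≈⟨ *-identityˡ _ ⟩
    inv j ^' k                        ∎)
  liOverX-pred -[1+ k ]  j = reflexive (P.cong (λ e → ι (suc j) * ι (suc j) ^' suc e) (ℕₚ.+-identityʳ k))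

  deriv-Li : ∀ k → deriv (oneMinusExpNeg ⊛ polyBGen k) ≋ (expNeg ⊛ polyBGen (k -ℤ + 1))
  deriv-Li k l = begin
    ι (suc l) * (y ⊛ composeS a y) (suc l)
      ≈⟨ *-congˡ (⊛-composeS refl y a (suc l) (suc l) ℕₚ.≤-refl) ⟩
    ι (suc l) * sumTo (suc l) (λ j → a j * powS y (suc j) (suc l))
      ≈⟨ *-distribˡ-sumTo (suc l) _ _ ⟩
    sumTo (suc l) (λ j → ι (suc l) * (a j * powS y (suc j) (suc l)))
      ≈⟨ sumTo-cong (suc l) (λ j → trans (x∙yz≈y∙xz _ _ _) (*-congˡ (deriv-power j))) ⟩
    sumTo (suc l) (λ j → a j * (ι (suc j) * (expNeg ⊛ powS y j) l))
      ≈⟨ sumTo-cong (suc l) (λ j → trans (x∙yz≈yx∙z _ _ _) (*-congʳ (sym (liOverX-pred k j)))) ⟩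
    sumTo (suc l) (λ j → a′ j * (expNeg ⊛ powS y j) l)
      ≈⟨ ⊛-composeS refl expNeg a′ l (suc l) (ℕₚ.n≤1+n l) ⟨
    (expNeg ⊛ composeS a′ y) l ∎
    where
    y a a′ : PS
    y  = oneMinusExpNeg
    a  = liOverX k
    a′ = liOverX (k -ℤ + 1)
    deriv-power : ∀ j → deriv (powS y (suc j)) l ≈ ι (suc j) * (expNeg ⊛ powS y j) l
    deriv-power j = trans (deriv-powS y j l) (*-congˡ (⊛-congˡ (powS y j) deriv-oneMinusExpNeg l))

  ⊛-expS0 : ∀ f → (f ⊛ expS 0#) ≋ f
  ⊛-expS0 f = ⊛-unitʳ f (expS 0#) (*-identityˡ _) (λ m → trans (*-congʳ (zeroˡ _)) (zeroˡ _))

  fact*⊛expNeg : ∀ f l → ι (l !) * (f ⊛ expNeg) l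
                           ≈ sumTo l (λ m → sign (l ∸ m) * binom l m * (ι (m !) * f m))
  fact*⊛expNeg f l = trans (*-distribˡ-sumTo l _ _) (sumTo-cong-≤ l (λ m m≤l →
    trans (fact*[x*[s*invFact]] m≤l (sign (l ∸ m)) (f m)) (*-congʳ (*-comm _ _))))

  fact*oneMinusExpNeg⊛ : ∀ f n → ι (suc n !) * (oneMinusExpNeg ⊛ f) (suc n)
                                   ≈ sumTo n (λ m → binom (suc n) m * sign (n ∸ m) * (ι (m !) * f m))
  fact*oneMinusExpNeg⊛ f n = begin
    ι (suc n !) * (oneMinusExpNeg ⊛ f) (suc n)
      ≈⟨ *-congˡ (⊛-comm oneMinusExpNeg f (suc n)) ⟩
    ι (suc n !) * (f ⊛ oneMinusExpNeg) (suc n)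
      ≈⟨ *-congˡ (⊛-sucʳ f oneMinusExpNeg n refl) ⟩
    ι (suc n !) * sumTo n (λ m → f m * oneMinusExpNeg (suc n ∸ m))
      ≈⟨ *-distribˡ-sumTo n _ _ ⟩
    sumTo n (λ m → ι (suc n !) * (f m * oneMinusExpNeg (suc n ∸ m)))
      ≈⟨ sumTo-cong-≤ n (λ m m≤n → trans (*-congˡ (*-congˡ (coefficient m≤n)))
                                          (fact*[x*[s*invFact]] (ℕₚ.m≤n⇒m≤1+n m≤n) _ _)) ⟩
    sumTo n (λ m → binom (suc n) m * sign (n ∸ m) * (ι (m !) * f m)) ∎
    where
    coefficient : ∀ {m} → m ≤ n → oneMinusExpNeg (suc n ∸ m) ≈ sign (n ∸ m) * invFact (suc n ∸ m)
    coefficient {m} m≤n = begin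
      oneMinusExpNeg (suc n ∸ m)          ≡⟨ P.cong oneMinusExpNeg (ℕₚ.+-∸-assoc 1 m≤n) ⟩
      oneMinusExpNeg (suc (n ∸ m))        ≈⟨ oneMinusExpNeg-suc (n ∸ m) ⟩
      sign (n ∸ m) * invFact (suc (n ∸ m)) ≡⟨ P.cong (λ i → sign (n ∸ m) * invFact i) (ℕₚ.+-∸-assoc 1 m≤n) ⟨
      sign (n ∸ m) * invFact (suc n ∸ m)  ∎

  alternating-sum-B : ∀ k l →
    sumTo l (λ m → sign (l ∸ m) * binom l m * B (k -ℤ + 1) m)
      ≈ ι (suc l !) * (oneMinusExpNeg ⊛ polyBGen k) (suc l)
  alternating-sum-B k l = begin
    sumTo l (λ m → sign (l ∸ m) * binom l m * (ι (m !) * polyBGen (k -ℤ + 1) m))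
      ≈⟨ fact*⊛expNeg (polyBGen (k -ℤ + 1)) l ⟨
    ι (l !) * (polyBGen (k -ℤ + 1) ⊛ expNeg) l
      ≈⟨ *-congˡ (⊛-comm (polyBGen (k -ℤ + 1)) expNeg l) ⟩
    ι (l !) * (expNeg ⊛ polyBGen (k -ℤ + 1)) l
      ≈⟨ *-congˡ (deriv-Li k l) ⟨
    ι (l !) * (ι (suc l) * Y (suc l))
      ≈⟨ x∙yz≈yx∙z _ _ _ ⟩
    ι (suc l) * ι (l !) * Y (suc l)
      ≈⟨ *-congʳ (ι-* (suc l) (l !)) ⟨
    ι (suc l !) * Y (suc l) ∎
    where
    Y : PS
    Y = oneMinusExpNeg ⊛ polyBGen k

  alternating-double-sum-B : ∀ k (G : PS) n →
    sumTo n (λ l → sumTo l (λ m →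
      sign (l ∸ m) * binom l m * binom (suc n) (suc l)
        * B (k -ℤ + 1) m * (ι ((n ∸ l) !) * G (n ∸ l))))
      ≈ ι (suc n !) * (oneMinusExpNeg ⊛ (G ⊛ polyBGen k)) (suc n)
  alternating-double-sum-B k G n = begin
    sumTo n (λ l → sumTo l (λ m →
      sign (l ∸ m) * binom l m * binom (suc n) (suc l) * B (k -ℤ + 1) m * Gₗ l))
      ≈⟨ sumTo-cong-≤ n row ⟩
    sumTo n (λ l → ι (suc n !) * (Y (suc l) * G (n ∸ l)))
      ≈⟨ *-distribˡ-sumTo n _ _ ⟨
    ι (suc n !) * sumTo n (λ l → Y (suc l) * G (n ∸ l))
      ≈⟨ *-congˡ (⊛-sucˡ Y G n (zeroˡ _)) ⟨
    ι (suc n !) * (Y ⊛ G) (suc n)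
      ≈⟨ *-congˡ (trans (⊛-assoc oneMinusExpNeg P G (suc n))
                        (⊛-congʳ oneMinusExpNeg (⊛-comm P G) (suc n))) ⟩
    ι (suc n !) * (oneMinusExpNeg ⊛ (G ⊛ P)) (suc n) ∎
    where
    P Y : PS
    P = polyBGen k
    Y = oneMinusExpNeg ⊛ P
    Gₗ : ℕ → Carrier
    Gₗ l = ι ((n ∸ l) !) * G (n ∸ l)
    row : ∀ l → l ≤ n →
      sumTo l (λ m → sign (l ∸ m) * binom l m * binom (suc n) (suc l) * B (k -ℤ + 1) m * Gₗ l)
        ≈ ι (suc n !) * (Y (suc l) * G (n ∸ l))
    row l l≤n = begin
      sumTo l (λ m → sign (l ∸ m) * binom l m * binom (suc n) (suc l) * B (k -ℤ + 1) m * Gₗ l)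
        ≈⟨ sumTo-cong l (λ m → solve 5 (λ s b c β g → (((s · b) · c) · β) · g ⊜ ((s · b) · β) · (c · g))
                                      refl _ _ _ _ _) ⟩
      sumTo l (λ m → sign (l ∸ m) * binom l m * B (k -ℤ + 1) m * (binom (suc n) (suc l) * Gₗ l))
        ≈⟨ *-distribʳ-sumTo l _ _ ⟨
      sumTo l (λ m → sign (l ∸ m) * binom l m * B (k -ℤ + 1) m) * (binom (suc n) (suc l) * Gₗ l)
        ≈⟨ *-congʳ (alternating-sum-B k l) ⟩
      ι (suc l !) * Y (suc l) * (binom (suc n) (suc l) * (ι ((n ∸ l) !) * G (n ∸ l)))
        ≈⟨ solve 5 (λ f y b f′ g → (f · y) · (b · (f′ · g)) ⊜ (b · (f · f′)) · (y · g)) refl _ _ _ _ _ ⟩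
      binom (suc n) (suc l) * (ι (suc l !) * ι ((n ∸ l) !)) * (Y (suc l) * G (n ∸ l))
        ≈⟨ *-congʳ (fact≈binom*fact*fact (s≤s l≤n)) ⟨
      ι (suc n !) * (Y (suc l) * G (n ∸ l)) ∎

theorem6 : ∀ {c ℓ : Level} (R : CommutativeRing c ℓ)
             (inv : ℕ → CommutativeRing.Carrier R) →
             let open CommutativeRing R
                 open Series R inv
             in (∀ n → ι (suc n) * inv n ≈ 1#) →
                (lam μ : Carrier) → (1# - lam) * μ ≈ 1# →
                (r k : ℤ) (n : ℕ) →
                sumTo n (λ m → binom (suc n) m * sign (n ∸ m) * T r k μ m)
                  ≈ sumTo n (λ l → sumTo l (λ m →
                      sign (l ∸ m) * binom l m * binom (suc n) (suc l)
                        * B (k -ℤ + 1) m * H r μ (n ∸ l)))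
-- λ enters only through μ = 1/(1 - λ): the identity holds for every μ.
theorem6 R inv ι[1+n]*inv[n]≈1 _ μ _ r k n = begin
  sumTo n (λ m → binom (suc n) m * sign (n ∸ m) * T r k μ m)
    ≈⟨ sumTo-cong n (λ m → *-congˡ (*-congˡ (⊛-expS0 (G ⊛ P) m))) ⟩
  sumTo n (λ m → binom (suc n) m * sign (n ∸ m) * (ι (m !) * (G ⊛ P) m))
    ≈⟨ fact*oneMinusExpNeg⊛ (G ⊛ P) n ⟨
  ι (suc n !) * (oneMinusExpNeg ⊛ (G ⊛ P)) (suc n)
    ≈⟨ alternating-double-sum-B k G n ⟨
  sumTo n (λ l → sumTo l (λ m →
    sign (l ∸ m) * binom l m * binom (suc n) (suc l) * B (k -ℤ + 1) m * H r μ (n ∸ l))) ∎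
  where
  open CommutativeRing R
  open Series R inv
  open SeriesAlgebra R inv using (sumTo-cong)
  open ExponentialCoefficients R inv ι[1+n]*inv[n]≈1
  open import Relation.Binary.Reasoning.Setoid setoid
  G P : PS
  G = FEpow μ r
  P = polyBGen k
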